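{- For all integers $n\geq 0$, $\bar{B}_{5,2}(4n+3)\equiv 0 \pmod 4$.
   Context: An overpartition of a positive integer $n$ is a partition of $n$ in which the first occurrence of each distinct part may be overlined. For coprime integers $\ell_1,\ell_2>1$, $\bar{B}_{\ell_1,\ell_2}(n)$ denotes the number of overpartitions of $n$ in which no part is divisible by $\ell_1$ or by $\ell_2$, with $\bar{B}_{\ell_1,\ell_2}(0)=1$. -}

module Defs where

open import Data.Nat using (ℕ; zero; suc; _+_; _≤_; _<_; _≟_; _≤?_; _<?_)
open import Data.Nat.Divisibility using (_∣_; _∣?_)
open import Data.Bool using (Bool; true; false)
open import Data.Product using (_×_; _,_; proj₁)
open import Data.List using (List; []; _∷_; length; filter; map; concatMap; upTo)
open import Data.Nat.ListAction using (sum)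
open import Relation.Nullary using (¬_; Dec; yes; no)
open import Relation.Nullary.Decidable using (_×-dec_; ¬?)
open import Relation.Unary using (Decidable)
open import Relation.Binary.PropositionalEquality using (_≡_; refl)

-- An overpartition is represented canonically as a list of marked parts
-- (k , b) : part size k, b = true iff this occurrence is overlined.
-- Canonical order: parts weakly decreasing; among equal parts the (unique
-- allowed) overlined copy comes first, i.e. it is the "first occurrence".
MarkedPart : Set
MarkedPart = ℕ × Bool

data Precedes : MarkedPart → MarkedPart → Set where
  strict : ∀ {k₁ k₂ b₁ b₂} → k₂ < k₁ → Precedes (k₁ , b₁) (k₂ , b₂)
  same   : ∀ {k b} → Precedes (k , b) (k , false)

precedes? : ∀ p q → Dec (Precedes p q)
precedes? (k₁ , b₁) (k₂ , b₂) with k₂ <? k₁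
... | yes lt = yes (strict lt)
... | no nlt with k₁ ≟ k₂ | b₂
...   | yes refl | false = yes same
...   | yes refl | true  = no λ { (strict lt) → nlt lt }
...   | no neq   | _     = no λ { (strict lt) → nlt lt ; same → neq refl }

data Chain : List MarkedPart → Set where
  []  : Chain []
  [_] : ∀ p → Chain (p ∷ [])
  _∷_ : ∀ {p q ps} → Precedes p q → Chain (q ∷ ps) → Chain (p ∷ q ∷ ps)

chain? : ∀ ps → Dec (Chain ps)
chain? [] = yes []
chain? (p ∷ []) = yes [ p ]
chain? (p ∷ q ∷ ps) with precedes? p q | chain? (q ∷ ps)
... | yes a | yes c = yes (a ∷ c)
... | no na | _     = no λ { (a ∷ _) → na a }
... | _     | no nc = no λ { (_ ∷ c) → nc c }

weight : List MarkedPart → ℕ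
weight ps = sum (map proj₁ ps)

data AllPos : List MarkedPart → Set where
  []  : AllPos []
  _∷_ : ∀ {k b ps} → 1 ≤ k → AllPos ps → AllPos ((k , b) ∷ ps)

allPos? : ∀ ps → Dec (AllPos ps)
allPos? [] = yes []
allPos? ((k , b) ∷ ps) with 1 ≤? k | allPos? ps
... | yes a | yes r = yes (a ∷ r)
... | no na | _     = no λ { (a ∷ _) → na a }
... | _     | no nr = no λ { (_ ∷ r) → nr r }

data NoPartDiv (ℓ₁ ℓ₂ : ℕ) : List MarkedPart → Set where
  []  : NoPartDiv ℓ₁ ℓ₂ []
  _∷_ : ∀ {k b ps} → ¬ (ℓ₁ ∣ k) × ¬ (ℓ₂ ∣ k) → NoPartDiv ℓ₁ ℓ₂ ps
      → NoPartDiv ℓ₁ ℓ₂ ((k , b) ∷ ps)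

noPartDiv? : ∀ ℓ₁ ℓ₂ ps → Dec (NoPartDiv ℓ₁ ℓ₂ ps)
noPartDiv? ℓ₁ ℓ₂ [] = yes []
noPartDiv? ℓ₁ ℓ₂ ((k , b) ∷ ps) with (¬? (ℓ₁ ∣? k) ×-dec ¬? (ℓ₂ ∣? k)) | noPartDiv? ℓ₁ ℓ₂ ps
... | yes a | yes r = yes (a ∷ r)
... | no na | _     = no λ { (a ∷ _) → na a }
... | _     | no nr = no λ { (_ ∷ r) → nr r }

IsOverpartition : ℕ → List MarkedPart → Set
IsOverpartition n ps = AllPos ps × Chain ps × weight ps ≡ n

isOverpartition? : ∀ n ps → Dec (IsOverpartition n ps)
isOverpartition? n ps = allPos? ps ×-dec (chain? ps ×-dec (weight ps ≟ n))

IsB : ℕ → ℕ → ℕ → List MarkedPart → Set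
IsB ℓ₁ ℓ₂ n ps = IsOverpartition n ps × NoPartDiv ℓ₁ ℓ₂ ps

isB? : ∀ ℓ₁ ℓ₂ n ps → Dec (IsB ℓ₁ ℓ₂ n ps)
isB? ℓ₁ ℓ₂ n ps = isOverpartition? n ps ×-dec noPartDiv? ℓ₁ ℓ₂ ps

-- Every overpartition of n lies in candidates n
-- (it has at most n parts, each of size ≤ n); the list has no duplicates.
markedUpTo : ℕ → List MarkedPart
markedUpTo m = concatMap (λ k → (k , false) ∷ (k , true) ∷ []) (upTo (suc m))

listsOfLength : ℕ → List MarkedPart → List (List MarkedPart)
listsOfLength zero    xs = [] ∷ []
listsOfLength (suc l) xs = concatMap (λ x → map (x ∷_) (listsOfLength l xs)) xs

candidates : ℕ → List (List MarkedPart)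
candidates n = concatMap (λ l → listsOfLength l (markedUpTo n)) (upTo (suc n))

Bbar : ℕ → ℕ → ℕ → ℕ
Bbar ℓ₁ ℓ₂ n = length (filter (isB? ℓ₁ ℓ₂ n) (candidates n))

-- Toggling the overline on the largest part is a fixed-point-free involution on the nonempty
-- overpartitions counted by B̄(N), so B̄(N) = 2Y where Y counts those whose largest part j is not
-- overlined.  Modulo 2, Y counts only the overpartitions j + j + ⋯ + j: any other one has parts
-- below j, and toggling the overline on the largest of them pairs it off.  Hence Y is congruent
-- mod 2 to the number of allowed divisors of N.  For (ℓ₁, ℓ₂) = (5, 2) and N ≡ 3 (mod 4) these
-- are the divisors of N prime to 5, i.e. the divisors of the 5-free part N′ of N; as
-- N′ ≡ 3 (mod 4) is not a square, d ↦ N′ / d pairs them off, so Y is even and 4 ∣ B̄(N).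
module Submission where

open import Defs
open import Data.Bool using (Bool; true; false)
open import Data.List using (List; []; _∷_; _++_; map; concatMap; applyUpTo; upTo; length; filter)
open import Data.List.Properties using (map-++; map-cong)
open import Data.Nat
open import Data.Nat.Coprimality using (Coprime; coprime-divisor)
open import Data.Nat.Divisibility
open import Data.Nat.DivMod
open import Data.Nat.Induction using (<-rec)
open import Data.Nat.ListAction using (sum)
open import Data.Nat.ListAction.Properties using (sum-++)
open import Data.Nat.Primality using (Prime; prime?; prime⇒irreducible; prime⇒nonZero; prime⇒nonTrivial)
open import Data.Nat.Properties
open import Data.Parity using (0ℙ) renaming (_+_ to _ℙ+_)
import Data.Parity.Properties as ℙ
open import Data.Product using (_×_; _,_; proj₁; proj₂)
open import Data.Sum using (inj₁; inj₂)
open import Function using (_∘_; _⇔_; mk⇔; Equivalence)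
open import Relation.Binary.Definitions using (tri<; tri≈; tri>)
open import Relation.Binary.PropositionalEquality
open import Relation.Nullary using (¬_; Dec; yes; no; contradiction)
open import Relation.Nullary.Decidable using (_×-dec_; ¬?; from-yes)
open import Relation.Unary using (Decidable)
open import Algebra.Properties.CommutativeSemigroup +-commutativeSemigroup
  using () renaming (interchange to +-interchange)
open ≡-Reasoning

private variable
  A B : Set

𝟙 : {P : Set} → Dec P → ℕ
𝟙 (yes _) = 1
𝟙 (no _)  = 0

𝟙-yes : {P : Set} (p? : Dec P) → P → 𝟙 p? ≡ 1
𝟙-yes (yes _) _ = refl
𝟙-yes (no ¬p) p = contradiction p ¬p

𝟙-no : {P : Set} (p? : Dec P) → ¬ P → 𝟙 p? ≡ 0
𝟙-no (yes p) ¬p = contradiction p ¬p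
𝟙-no (no _)  _  = refl

𝟙-cong : {P Q : Set} (p? : Dec P) (q? : Dec Q) → P ⇔ Q → 𝟙 p? ≡ 𝟙 q?
𝟙-cong p? (yes q) P⇔Q = 𝟙-yes p? (Equivalence.from P⇔Q q)
𝟙-cong p? (no ¬q) P⇔Q = 𝟙-no p? (¬q ∘ Equivalence.to P⇔Q)

𝟙-split : {P Q : Set} (p? : Dec P) (q? : Dec Q) → 𝟙 p? ≡ 𝟙 (p? ×-dec ¬? q?) + 𝟙 (p? ×-dec q?)
𝟙-split (yes _) (yes _) = refl
𝟙-split (yes _) (no _)  = refl
𝟙-split (no _)  _       = refl

sum-map-++ : (f : A → ℕ) (xs ys : List A) → sum (map f (xs ++ ys)) ≡ sum (map f xs) + sum (map f ys)
sum-map-++ f xs ys = trans (cong sum (map-++ f xs ys)) (sum-++ (map f xs) (map f ys))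

sum-map-concatMap : (f : A → ℕ) (g : B → List A) (ys : List B) →
                    sum (map f (concatMap g ys)) ≡ sum (map (λ y → sum (map f (g y))) ys)
sum-map-concatMap f g []       = refl
sum-map-concatMap f g (y ∷ ys) =
  trans (sum-map-++ f (g y) (concatMap g ys)) (cong (sum (map f (g y)) +_) (sum-map-concatMap f g ys))

count : {P : A → Set} → Decidable P → List A → ℕ
count P? xs = sum (map (λ x → 𝟙 (P? x)) xs)

length-filter≡count : {P : A → Set} (P? : Decidable P) (xs : List A) → length (filter P? xs) ≡ count P? xs
length-filter≡count P? []       = refl
length-filter≡count P? (x ∷ xs) with P? x
... | yes _ = cong suc (length-filter≡count P? xs)
... | no _  = length-filter≡count P? xs

count-cong : {P Q : A → Set} (P? : Decidable P) (Q? : Decidable Q) →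
             (∀ x → P x ⇔ Q x) → ∀ xs → count P? xs ≡ count Q? xs
count-cong P? Q? P⇔Q []       = refl
count-cong P? Q? P⇔Q (x ∷ xs) = cong₂ _+_ (𝟙-cong (P? x) (Q? x) (P⇔Q x)) (count-cong P? Q? P⇔Q xs)

count-none : {P : A → Set} (P? : Decidable P) → (∀ x → ¬ P x) → ∀ xs → count P? xs ≡ 0
count-none P? ¬P []       = refl
count-none P? ¬P (x ∷ xs) = cong₂ _+_ (𝟙-no (P? x) (¬P x)) (count-none P? ¬P xs)

count-map : {P : A → Set} (P? : Decidable P) (f : B → A) (ys : List B) →
            count P? (map f ys) ≡ count (λ y → P? (f y)) ys
count-map P? f []       = refl
count-map P? f (y ∷ ys) = cong (𝟙 (P? (f y)) +_) (count-map P? f ys)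

count-×ˡ : {Q : Set} {P : A → Set} (q? : Dec Q) (P? : Decidable P) (xs : List A) →
           count (λ x → q? ×-dec P? x) xs ≡ 𝟙 q? * count P? xs
count-×ˡ (yes q) P? xs = trans (count-cong _ P? (λ _ → mk⇔ proj₂ (q ,_)) xs) (sym (+-identityʳ _))
count-×ˡ (no ¬q) P? xs = count-none (λ x → no ¬q ×-dec P? x) (λ _ → ¬q ∘ proj₁) xs

∑< : ℕ → (ℕ → ℕ) → ℕ
∑< n f = sum (applyUpTo f n)

syntax ∑< n (λ i → x) = ∑[ i < n ] x

sum-map-applyUpTo : ∀ (f g : ℕ → ℕ) n → sum (map f (applyUpTo g n)) ≡ ∑< n (f ∘ g)
sum-map-applyUpTo f g zero    = refl
sum-map-applyUpTo f g (suc n) = cong (f (g 0) +_) (sum-map-applyUpTo f (g ∘ suc) n)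

∑-cong : ∀ n {f g : ℕ → ℕ} → (∀ {i} → i < n → f i ≡ g i) → ∑< n f ≡ ∑< n g
∑-cong zero    eq = refl
∑-cong (suc n) eq = cong₂ _+_ (eq z<s) (∑-cong n (eq ∘ s<s))

∑-zero : ∀ n {f : ℕ → ℕ} → (∀ {i} → i < n → f i ≡ 0) → ∑< n f ≡ 0
∑-zero zero    eq = refl
∑-zero (suc n) eq = cong₂ _+_ (eq z<s) (∑-zero n (eq ∘ s<s))

∑-distrib-+ : ∀ n (f g : ℕ → ℕ) → ∑[ i < n ] (f i + g i) ≡ ∑< n f + ∑< n g
∑-distrib-+ zero    f g = refl
∑-distrib-+ (suc n) f g = begin
  f 0 + g 0 + ∑[ i < n ] (f (suc i) + g (suc i))  ≡⟨ cong (f 0 + g 0 +_) (∑-distrib-+ n (f ∘ suc) (g ∘ suc)) ⟩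
  f 0 + g 0 + (∑< n (f ∘ suc) + ∑< n (g ∘ suc))  ≡⟨ +-interchange (f 0) (g 0) _ _ ⟩
  f 0 + ∑< n (f ∘ suc) + (g 0 + ∑< n (g ∘ suc))  ∎

∑-comm : ∀ m n (f : ℕ → ℕ → ℕ) → ∑[ i < m ] ∑[ j < n ] f i j ≡ ∑[ j < n ] ∑[ i < m ] f i j
∑-comm zero    n f = sym (∑-zero n (λ _ → refl))
∑-comm (suc m) n f = begin
  ∑< n (f 0) + ∑[ i < m ] ∑[ j < n ] f (suc i) j  ≡⟨ cong (∑< n (f 0) +_) (∑-comm m n (f ∘ suc)) ⟩
  ∑< n (f 0) + ∑[ j < n ] ∑[ i < m ] f (suc i) j  ≡⟨ ∑-distrib-+ n (f 0) _ ⟨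
  ∑[ j < n ] ∑[ i < suc m ] f i j                  ∎

∑-split : ∀ m n (f : ℕ → ℕ) → ∑< (m + n) f ≡ ∑< m f + ∑[ i < n ] f (m + i)
∑-split zero    n f = refl
∑-split (suc m) n f = trans (cong (f 0 +_) (∑-split m n (f ∘ suc))) (sym (+-assoc (f 0) _ _))

∑-suc : ∀ n (f : ℕ → ℕ) → ∑< (suc n) f ≡ ∑< n f + f n
∑-suc n f = begin
  ∑< (suc n) f              ≡⟨ cong (λ m → ∑< m f) (+-comm 1 n) ⟩
  ∑< (n + 1) f              ≡⟨ ∑-split n 1 f ⟩
  ∑< n f + (f (n + 0) + 0)  ≡⟨ cong (∑< n f +_) (trans (+-identityʳ _) (cong f (+-identityʳ n))) ⟩
  ∑< n f + f n              ∎

∑-single : ∀ n {k} (f : ℕ → ℕ) → k < n → (∀ {i} → i < n → i ≢ k → f i ≡ 0) → ∑< n f ≡ f k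
∑-single (suc n) {zero}  f _         vanish =
  trans (cong (f 0 +_) (∑-zero n (λ i<n → vanish (s<s i<n) (λ ())))) (+-identityʳ (f 0))
∑-single (suc n) {suc k} f (s<s k<n) vanish =
  trans (cong (_+ ∑< n (f ∘ suc)) (vanish z<s (λ ())))
        (∑-single n (f ∘ suc) k<n (λ i<n i≢k → vanish (s<s i<n) (i≢k ∘ suc-injective)))

parity-∑-cong : ∀ n {f g : ℕ → ℕ} → (∀ {i} → i < n → parity (f i) ≡ parity (g i)) →
                parity (∑< n f) ≡ parity (∑< n g)
parity-∑-cong zero    eq = refl
parity-∑-cong (suc n) {f} {g} eq = begin
  parity (f 0 + ∑< n (f ∘ suc))             ≡⟨ ℙ.+-homo-+ (f 0) _ ⟩
  parity (f 0) ℙ+ parity (∑< n (f ∘ suc))  ≡⟨ cong₂ _ℙ+_ (eq z<s) (parity-∑-cong n (eq ∘ s<s)) ⟩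
  parity (g 0) ℙ+ parity (∑< n (g ∘ suc))  ≡⟨ ℙ.+-homo-+ (g 0) _ ⟨
  parity (g 0 + ∑< n (g ∘ suc))             ∎

parity-∑-single : ∀ n {k} (f : ℕ → ℕ) → k < n → (∀ {i} → i < n → i ≢ k → parity (f i) ≡ 0ℙ) →
                  parity (∑< n f) ≡ parity (f k)
parity-∑-single n {k} f k<n even = begin
  parity (∑< n f)   ≡⟨ parity-∑-cong n f≈g ⟩
  parity (∑< n g)   ≡⟨ cong parity (∑-single n g k<n (λ _ i≢k → cong (_* f k) (𝟙-no (_ ≟ k) i≢k))) ⟩
  parity (g k)      ≡⟨ cong (λ x → parity (x * f k)) (𝟙-yes (k ≟ k) refl) ⟩
  parity (1 * f k)  ≡⟨ cong parity (*-identityˡ (f k)) ⟩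
  parity (f k)      ∎
  where
  g : ℕ → ℕ
  g i = 𝟙 (i ≟ k) * f k
  f≈g : ∀ {i} → i < n → parity (f i) ≡ parity (g i)
  f≈g {i} i<n with i ≟ k
  ... | yes refl = cong parity (sym (+-identityʳ (f i)))
  ... | no i≢k   = even i<n i≢k

parity≡0ℙ⇒2∣ : ∀ n → parity n ≡ 0ℙ → 2 ∣ n
parity≡0ℙ⇒2∣ zero          _    = 2 ∣0
parity≡0ℙ⇒2∣ (suc (suc n)) even = ∣m∣n⇒∣m+n (∣-refl {2}) (parity≡0ℙ⇒2∣ n even)

2∣⇒4∣m+m : ∀ {m} → 2 ∣ m → 4 ∣ m + m
2∣⇒4∣m+m (divides q refl) = divides q (sym (*-distribˡ-+ q 2 2))

FixedPointFreeInvolutionOn : ℕ → (ℕ → Set) → (ℕ → ℕ) → Set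
FixedPointFreeInvolutionOn m P σ = ∀ {k} → k < m → P k → σ k < m × P (σ k) × σ (σ k) ≡ k × σ k ≢ k

parity-count-involution : ∀ m {P : ℕ → Set} (P? : Decidable P) (σ : ℕ → ℕ) →
                          FixedPointFreeInvolutionOn m P σ → parity (∑[ k < m ] 𝟙 (P? k)) ≡ 0ℙ
parity-count-involution zero    P? σ inv = refl
parity-count-involution (suc m) {P} P? σ inv with P? m
... | no ¬Pm = begin
  parity (∑[ k < suc m ] 𝟙 (P? k))         ≡⟨ cong parity (∑-suc m _) ⟩
  parity (∑[ k < m ] 𝟙 (P? k) + 𝟙 (P? m))  ≡⟨ cong (λ x → parity (∑[ k < m ] 𝟙 (P? k) + x)) (𝟙-no (P? m) ¬Pm) ⟩
  parity (∑[ k < m ] 𝟙 (P? k) + 0)         ≡⟨ cong parity (+-identityʳ (∑[ k < m ] 𝟙 (P? k))) ⟩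
  parity (∑[ k < m ] 𝟙 (P? k))             ≡⟨ parity-count-involution m P? σ restricted ⟩
  0ℙ                                        ∎
  where
  restricted : FixedPointFreeInvolutionOn m P σ
  restricted k<m Pk with inv (m<n⇒m<1+n k<m) Pk
  ... | σk<1+m , Pσk , σσk≡k , σk≢k =
    ≤∧≢⇒< (≤-pred σk<1+m) (λ σk≡m → ¬Pm (subst P σk≡m Pσk)) , Pσk , σσk≡k , σk≢k
... | yes Pm with inv ≤-refl Pm
... | σm<1+m , Pσm , σσm≡m , σm≢m = begin
  parity (∑[ k < suc m ] 𝟙 (P? k))         ≡⟨ cong parity (∑-suc m _) ⟩
  parity (∑[ k < m ] 𝟙 (P? k) + 𝟙 (P? m))  ≡⟨ cong₂ (λ x y → parity (x + y)) split (𝟙-yes (P? m) Pm) ⟩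
  parity (rest + 1 + 1)                     ≡⟨ cong parity (trans (+-assoc rest 1 1) (+-comm rest 2)) ⟩
  parity (2 + rest)                         ≡⟨ parity-count-involution m P′? σ restricted ⟩
  0ℙ                                        ∎
  where
  c = σ m
  c<m : c < m
  c<m = ≤∧≢⇒< (≤-pred σm<1+m) σm≢m
  P′ : ℕ → Set
  P′ k = P k × k ≢ c
  P′? : Decidable P′
  P′? k = P? k ×-dec ¬? (k ≟ c)
  rest : ℕ
  rest = ∑[ k < m ] 𝟙 (P′? k)
  split : ∑[ k < m ] 𝟙 (P? k) ≡ rest + 1
  split = begin
    ∑[ k < m ] 𝟙 (P? k)                             ≡⟨ ∑-cong m (λ {k} _ → 𝟙-split (P? k) (k ≟ c)) ⟩
    ∑[ k < m ] (𝟙 (P′? k) + 𝟙 (P? k ×-dec k ≟ c))  ≡⟨ ∑-distrib-+ m _ _ ⟩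
    rest + ∑[ k < m ] 𝟙 (P? k ×-dec k ≟ c)
      ≡⟨ cong (rest +_) (∑-single m _ c<m (λ {k} _ k≢c → 𝟙-no (P? k ×-dec k ≟ c) (k≢c ∘ proj₂))) ⟩
    rest + 𝟙 (P? c ×-dec c ≟ c)                     ≡⟨ cong (rest +_) (𝟙-yes (P? c ×-dec c ≟ c) (Pσm , refl)) ⟩
    rest + 1                                        ∎
  restricted : FixedPointFreeInvolutionOn m P′ σ
  restricted k<m (Pk , k≢c) with inv (m<n⇒m<1+n k<m) Pk
  ... | σk<1+m , Pσk , σσk≡k , σk≢k =
    ≤∧≢⇒< (≤-pred σk<1+m) (λ σk≡m → k≢c (trans (sym σσk≡k) (cong σ σk≡m))) ,
    (Pσk , λ σk≡c → <-irrefl (trans (sym σσk≡k) (trans (cong σ σk≡c) σσm≡m)) k<m) ,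
    σσk≡k , σk≢k

m+n≡o⇔m≤o×n≡o∸m : ∀ {m n o} → m + n ≡ o ⇔ (m ≤ o × n ≡ o ∸ m)
m+n≡o⇔m≤o×n≡o∸m {m} {n} {o} = mk⇔
  (λ m+n≡o → subst (m ≤_) m+n≡o (m≤m+n m n) , trans (sym (m+n∸m≡n m n)) (cong (_∸ m) m+n≡o))
  (λ (m≤o , n≡o∸m) → trans (cong (m +_) n≡o∸m) (m+[n∸m]≡n m≤o))

∸≡⇔≡+ : ∀ {m n o} → m ≤ o → (o ∸ m ≡ n) ⇔ (o ≡ m + n)
∸≡⇔≡+ m≤o = mk⇔
  (λ o∸m≡n → sym (Equivalence.from m+n≡o⇔m≤o×n≡o∸m (m≤o , sym o∸m≡n)))
  (λ o≡m+n → sym (proj₂ (Equivalence.to m+n≡o⇔m≤o×n≡o∸m (sym o≡m+n))))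

square-mod-4≢3 : ∀ k → (k * k) % 4 ≢ 3
square-mod-4≢3 k k²≡3 = residue-square (k % 4) (m%n<n k 4) (trans (sym (%-distribˡ-* k k 4)) k²≡3)
  where
  residue-square : ∀ r → r < 4 → (r * r) % 4 ≢ 3
  residue-square 0 _ ()
  residue-square 1 _ ()
  residue-square 2 _ ()
  residue-square 3 _ ()
  residue-square (suc (suc (suc (suc _)))) (s≤s (s≤s (s≤s (s≤s ())))) _

≡3-mod-4⇒≢0 : ∀ {N} → N % 4 ≡ 3 → N ≢ 0
≡3-mod-4⇒≢0 N≡3 refl = contradiction N≡3 λ ()

≡3-mod-4⇒odd : ∀ {N} → N % 4 ≡ 3 → ¬ 2 ∣ N
≡3-mod-4⇒odd {N} N≡3 2∣N = contradiction 1≡0 λ ()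
  where
  1≡0 : 1 ≡ 0
  1≡0 = begin
    3 % 2      ≡⟨ cong (_% 2) N≡3 ⟨
    N % 4 % 2  ≡⟨ m∣n⇒o%n%m≡o%m 2 4 N (divides 2 refl) ⟩
    N % 2      ≡⟨ n∣m⇒m%n≡0 N 2 2∣N ⟩
    0          ∎

∤-prime⇒coprime : ∀ {p j} → Prime p → ¬ p ∣ j → Coprime j p
∤-prime⇒coprime p-prime p∤j (i∣j , i∣p) with prime⇒irreducible p-prime i∣p
... | inj₁ i≡1  = i≡1
... | inj₂ refl = contradiction i∣j p∤j

∑-𝟙-∸≡multiple : ∀ {j N} → 1 ≤ j → j ≤ N → ∑[ l < N ] 𝟙 (N ∸ j ≟ l * j) ≡ 𝟙 (j ∣? N)
∑-𝟙-∸≡multiple {j} {N} 1≤j j≤N with j ∣? N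
... | no j∤N =
  ∑-zero N (λ {l} _ → 𝟙-no (N ∸ j ≟ l * j) (j∤N ∘ divides (suc l) ∘ Equivalence.to (∸≡⇔≡+ j≤N)))
... | yes (divides zero N≡0) = contradiction (≤-trans 1≤j (≤-trans j≤N (≤-reflexive N≡0))) λ ()
... | yes (divides (suc q) N≡[1+q]j) =
  trans (∑-single N (λ l → 𝟙 (N ∸ j ≟ l * j)) q<N
                    (λ {i} _ i≢q → 𝟙-no (N ∸ j ≟ i * j) (i≢q ∘ cofactor-unique)))
        (𝟙-yes (N ∸ j ≟ q * j) (Equivalence.from (∸≡⇔≡+ j≤N) N≡[1+q]j))
  where
  instance
    _ : NonZero j
    _ = >-nonZero 1≤j
  q<N : q < N
  q<N = ≤-trans (m≤m*n (suc q) j) (≤-reflexive (sym N≡[1+q]j))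
  cofactor-unique : ∀ {i} → N ∸ j ≡ i * j → i ≡ q
  cofactor-unique N∸j≡ij =
    suc-injective (*-cancelʳ-≡ (suc _) (suc q) j (trans (sym (Equivalence.to (∸≡⇔≡+ j≤N) N∸j≡ij)) N≡[1+q]j))

divisorCount : {P : ℕ → Set} → Decidable P → ℕ → ℕ
divisorCount P? N = ∑[ j < suc N ] 𝟙 (P? j ×-dec j ∣? N)

divisorCount-cong : ∀ {P Q : ℕ → Set} (P? : Decidable P) (Q? : Decidable Q) {N} →
                    (∀ {j} → j ∣ N → P j ⇔ Q j) → divisorCount P? N ≡ divisorCount Q? N
divisorCount-cong P? Q? {N} P⇔Q = ∑-cong (suc N) λ {j} _ → 𝟙-cong (P? j ×-dec j ∣? N) (Q? j ×-dec j ∣? N)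
  (mk⇔ (λ (Pj , j∣N) → Equivalence.to (P⇔Q j∣N) Pj , j∣N)
        (λ (Qj , j∣N) → Equivalence.from (P⇔Q j∣N) Qj , j∣N))

divisorCount-extend : ∀ {P : ℕ → Set} (P? : Decidable P) {M n} → M ≢ 0 → M ≤ n →
                      ∑[ j < suc n ] 𝟙 (P? j ×-dec j ∣? M) ≡ divisorCount P? M
divisorCount-extend P? {M} {n} M≢0 M≤n = begin
  ∑< (suc n) h                                 ≡⟨ cong (λ m → ∑< (suc m) h) (m+[n∸m]≡n M≤n) ⟨
  ∑< (suc M + (n ∸ M)) h                       ≡⟨ ∑-split (suc M) (n ∸ M) h ⟩
  ∑< (suc M) h + ∑[ i < n ∸ M ] h (suc M + i)  ≡⟨ cong (∑< (suc M) h +_) (∑-zero (n ∸ M) beyond-M) ⟩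
  ∑< (suc M) h + 0                             ≡⟨ +-identityʳ _ ⟩
  ∑< (suc M) h                                 ∎
  where
  h : ℕ → ℕ
  h j = 𝟙 (P? j ×-dec j ∣? M)
  beyond-M : ∀ {i} → i < n ∸ M → h (suc M + i) ≡ 0
  beyond-M {i} _ = 𝟙-no (P? (suc M + i) ×-dec _) (>⇒∤ {{≢-nonZero M≢0}} (s≤s (m≤m+n M i)) ∘ proj₂)

divisorCount-even : ∀ {P : ℕ → Set} (P? : Decidable P) {N} → N % 4 ≡ 3 →
                    (∀ {j q} → N ≡ q * j → P j → P q) → parity (divisorCount P? N) ≡ 0ℙ
divisorCount-even {P} P? {N} N≡3 closed =
  parity-count-involution (suc N) (λ j → P? j ×-dec j ∣? N) complement pairing
  where
  N≢0 = ≡3-mod-4⇒≢0 N≡3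
  complement : ℕ → ℕ
  complement zero    = zero
  complement (suc j) = N / suc j
  complement-∣ : ∀ {j q} → N ≡ q * j → complement j ≡ q
  complement-∣ {zero}  {q} N≡q*0 = contradiction (trans N≡q*0 (*-zeroʳ q)) N≢0
  complement-∣ {suc j} {q} N≡q*j = trans (/-congˡ N≡q*j) (m*n/n≡m q (suc j))
  pairing : FixedPointFreeInvolutionOn (suc N) (λ j → P j × j ∣ N) complement
  pairing {j} _ (Pj , divides q N≡q*j) =
    subst (λ c → c < suc N × (P c × c ∣ N) × complement c ≡ j × c ≢ j) (sym (complement-∣ N≡q*j))
      (s≤s (∣⇒≤ {{≢-nonZero N≢0}} q∣N) , (closed N≡q*j Pj , q∣N) , complement-∣ N≡j*q , q≢j)
    where
    N≡j*q : N ≡ j * q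
    N≡j*q = trans N≡q*j (*-comm q j)
    q∣N : q ∣ N
    q∣N = divides j N≡j*q
    q≢j : q ≢ j
    q≢j q≡j = square-mod-4≢3 j (subst (λ m → m % 4 ≡ 3) (trans N≡q*j (cong (_* j) q≡j)) N≡3)

module _ {p : ℕ} (p-prime : Prime p) where

  private
    instance
      p-nonZero : NonZero p
      p-nonZero = prime⇒nonZero p-prime

    p∤? : Decidable (λ j → ¬ p ∣ j)
    p∤? j = ¬? (p ∣? j)

  divisorCount-∤-*p : ∀ {M} → M ≢ 0 → divisorCount p∤? (M * p) ≡ divisorCount p∤? M
  divisorCount-∤-*p {M} M≢0 = begin
    ∑[ j < suc (M * p) ] 𝟙 (p∤? j ×-dec j ∣? M * p)
      ≡⟨ ∑-cong (suc (M * p)) (λ {j} _ →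
           𝟙-cong (p∤? j ×-dec j ∣? M * p) (p∤? j ×-dec j ∣? M) (mk⇔ drop-p add-p)) ⟩
    ∑[ j < suc (M * p) ] 𝟙 (p∤? j ×-dec j ∣? M)
      ≡⟨ divisorCount-extend p∤? M≢0 (m≤m*n M p) ⟩
    divisorCount p∤? M
      ∎
    where
    drop-p : ∀ {j} → ¬ p ∣ j × j ∣ M * p → ¬ p ∣ j × j ∣ M
    drop-p {j} (p∤j , j∣Mp) =
      p∤j , coprime-divisor (∤-prime⇒coprime p-prime p∤j) (subst (j ∣_) (*-comm M p) j∣Mp)
    add-p : ∀ {j} → ¬ p ∣ j × j ∣ M → ¬ p ∣ j × j ∣ M * p
    add-p (p∤j , j∣M) = p∤j , ∣-trans j∣M (m∣m*n p)

  divisorCount-∤-even : p % 4 ≡ 1 → ∀ N → N % 4 ≡ 3 → parity (divisorCount p∤? N) ≡ 0ℙ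
  divisorCount-∤-even p≡1 = <-rec _ step
    where
    step : ∀ N → (∀ {M} → M < N → M % 4 ≡ 3 → parity (divisorCount p∤? M) ≡ 0ℙ) →
           N % 4 ≡ 3 → parity (divisorCount p∤? N) ≡ 0ℙ
    step N ih N≡3 with p ∣? N
    ... | no p∤N = divisorCount-even p∤? N≡3 λ {j} {q} N≡q*j _ p∣q →
                     p∤N (∣-trans p∣q (divides j (trans N≡q*j (*-comm q j))))
    ... | yes (divides M refl) = trans (cong parity (divisorCount-∤-*p M≢0)) (ih M<N M≡3)
      where
      M≢0 : M ≢ 0
      M≢0 M≡0 = ≡3-mod-4⇒≢0 N≡3 (cong (_* p) M≡0)
      M<N : M < M * p
      M<N = m<m*n M p {{≢-nonZero M≢0}} (nonTrivial⇒n>1 p {{prime⇒nonTrivial p-prime}})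
      M≡3 : M % 4 ≡ 3
      M≡3 = begin
        M % 4                  ≡⟨ m%n%n≡m%n M 4 ⟨
        M % 4 % 4              ≡⟨ cong (_% 4) (*-identityʳ (M % 4)) ⟨
        (M % 4 * 1) % 4        ≡⟨ cong (λ x → (M % 4 * x) % 4) p≡1 ⟨
        (M % 4 * (p % 4)) % 4  ≡⟨ %-distribˡ-* M p 4 ⟨
        (M * p) % 4            ≡⟨ N≡3 ⟩
        3                      ∎

chain-reoverline : ∀ {j b b′ t} → Chain ((j , b) ∷ t) → Chain ((j , b′) ∷ t)
chain-reoverline [ _ ]           = [ _ ]
chain-reoverline (strict lt ∷ c) = strict lt ∷ c
chain-reoverline (same ∷ c)      = same ∷ c

module _ (ℓ₁ ℓ₂ : ℕ) where

  Allowed : ℕ → Set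
  Allowed j = ¬ ℓ₁ ∣ j × ¬ ℓ₂ ∣ j

  allowed? : Decidable Allowed
  allowed? j = ¬? (ℓ₁ ∣? j) ×-dec ¬? (ℓ₂ ∣? j)

  PositiveAllowed : ℕ → Set
  PositiveAllowed j = 1 ≤ j × Allowed j

  positiveAllowed? : Decidable PositiveAllowed
  positiveAllowed? j = 1 ≤? j ×-dec allowed? j

  -- The overpartitions t of w into allowed parts that may follow a non-overlined part k:
  -- all parts of t are at most k, and those equal to k are not overlined.
  Tail : ℕ → ℕ → List MarkedPart → Set
  Tail k w t = Chain ((k , false) ∷ t) × AllPos t × NoPartDiv ℓ₁ ℓ₂ t × weight t ≡ w

  tail? : ∀ k w → Decidable (Tail k w)
  tail? k w t = chain? _ ×-dec (allPos? t ×-dec (noPartDiv? ℓ₁ ℓ₂ t ×-dec (weight t ≟ w)))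

  -- (j , b) ∷ t is counted by B̄(w), whichever b is.
  Completes : ℕ → ℕ → List MarkedPart → Set
  Completes j w t = 1 ≤ j × Allowed j × j ≤ w × Tail j (w ∸ j) t

  completes? : ∀ j w → Decidable (Completes j w)
  completes? j w t = 1 ≤? j ×-dec (allowed? j ×-dec (j ≤? w ×-dec tail? j (w ∸ j) t))

  IsB-∷⇔Completes : ∀ {w j b t} → IsB ℓ₁ ℓ₂ w ((j , b) ∷ t) ⇔ Completes j w t
  IsB-∷⇔Completes = mk⇔
    (λ { ((1≤j ∷ pos , c , jt≡w) , j-allowed ∷ allowed) →
      let j≤w , t≡w∸j = Equivalence.to m+n≡o⇔m≤o×n≡o∸m jt≡w
      in 1≤j , j-allowed , j≤w , chain-reoverline c , pos , allowed , t≡w∸j })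
    (λ (1≤j , j-allowed , j≤w , c , pos , allowed , t≡w∸j) →
      (1≤j ∷ pos , chain-reoverline c , Equivalence.from m+n≡o⇔m≤o×n≡o∸m (j≤w , t≡w∸j)) ,
      j-allowed ∷ allowed)

  Tail-∷⇔Completes : ∀ {k w j b t} → Tail k w ((j , b) ∷ t) ⇔ (Precedes (k , false) (j , b) × Completes j w t)
  Tail-∷⇔Completes = mk⇔
    (λ { (k≥j ∷ c , 1≤j ∷ pos , j-allowed ∷ allowed , jt≡w) →
      let j≤w , t≡w∸j = Equivalence.to m+n≡o⇔m≤o×n≡o∸m jt≡w
      in k≥j , 1≤j , j-allowed , j≤w , chain-reoverline c , pos , allowed , t≡w∸j })
    (λ (k≥j , 1≤j , j-allowed , j≤w , c , pos , allowed , t≡w∸j) →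
      k≥j ∷ chain-reoverline c , 1≤j ∷ pos , j-allowed ∷ allowed ,
      Equivalence.from m+n≡o⇔m≤o×n≡o∸m (j≤w , t≡w∸j))

  Completes⇔Tail : ∀ {j w t} → 1 ≤ j → Allowed j → j ≤ w → Completes j w t ⇔ Tail j (w ∸ j) t
  Completes⇔Tail 1≤j j-allowed j≤w = mk⇔ (proj₂ ∘ proj₂ ∘ proj₂) (λ tail → 1≤j , j-allowed , j≤w , tail)

  module _ (N : ℕ) where

    Words : ℕ → List (List MarkedPart)
    Words l = listsOfLength l (markedUpTo N)

    sum-markedUpTo : (f : MarkedPart → ℕ) →
                     sum (map f (markedUpTo N)) ≡ ∑[ j < suc N ] (f (j , false) + f (j , true))
    sum-markedUpTo f = begin
      sum (map f (markedUpTo N))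
        ≡⟨ sum-map-concatMap f (λ j → (j , false) ∷ (j , true) ∷ []) (upTo (suc N)) ⟩
      sum (map (λ j → f (j , false) + (f (j , true) + 0)) (upTo (suc N)))
        ≡⟨ sum-map-applyUpTo (λ j → f (j , false) + (f (j , true) + 0)) (λ j → j) (suc N) ⟩
      ∑[ j < suc N ] (f (j , false) + (f (j , true) + 0))
        ≡⟨ ∑-cong (suc N) (λ {j} _ → cong (f (j , false) +_) (+-identityʳ (f (j , true)))) ⟩
      ∑[ j < suc N ] (f (j , false) + f (j , true))
        ∎

    count-Words-suc : ∀ l {P : List MarkedPart → Set} (P? : Decidable P) →
                      count P? (Words (suc l)) ≡
                      ∑[ j < suc N ] (count (λ t → P? ((j , false) ∷ t)) (Words l) +
                                      count (λ t → P? ((j , true) ∷ t)) (Words l))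
    count-Words-suc l P? = begin
      count P? (Words (suc l))
        ≡⟨ sum-map-concatMap (λ t → 𝟙 (P? t)) (λ x → map (x ∷_) (Words l)) (markedUpTo N) ⟩
      sum (map (λ x → count P? (map (x ∷_) (Words l))) (markedUpTo N))
        ≡⟨ cong sum (map-cong (λ x → count-map P? (x ∷_) (Words l)) (markedUpTo N)) ⟩
      sum (map (λ x → count (λ t → P? (x ∷ t)) (Words l)) (markedUpTo N))
        ≡⟨ sum-markedUpTo (λ x → count (λ t → P? (x ∷ t)) (Words l)) ⟩
      _ ∎

    count-Tail-∷ : ∀ {k w} j b l → count (λ t → tail? k w ((j , b) ∷ t)) (Words l) ≡
                   𝟙 (precedes? (k , false) (j , b)) * count (completes? j w) (Words l)
    count-Tail-∷ {k} {w} j b l =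
      trans (count-cong (λ t → tail? k w ((j , b) ∷ t)) (λ t → precedes? (k , false) (j , b) ×-dec completes? j w t)
                        (λ _ → Tail-∷⇔Completes) (Words l))
            (count-×ˡ (precedes? (k , false) (j , b)) (completes? j w) (Words l))

    count-Tail-∷-precedes : ∀ {k w j b} l → Precedes (k , false) (j , b) →
                            count (λ t → tail? k w ((j , b) ∷ t)) (Words l) ≡ count (completes? j w) (Words l)
    count-Tail-∷-precedes {k} {w} {j} {b} l p =
      trans (count-Tail-∷ j b l)
            (trans (cong (_* count (completes? j w) (Words l)) (𝟙-yes (precedes? (k , false) (j , b)) p))
                   (+-identityʳ _))

    count-Tail-∷-¬precedes : ∀ {k w j b} l → ¬ Precedes (k , false) (j , b) →
                             count (λ t → tail? k w ((j , b) ∷ t)) (Words l) ≡ 0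
    count-Tail-∷-¬precedes {k} {w} {j} {b} l ¬p =
      trans (count-Tail-∷ j b l)
            (cong (_* count (completes? j w) (Words l)) (𝟙-no (precedes? (k , false) (j , b)) ¬p))

    -- Tails starting with a part j < k come in pairs (j overlined or not), and none starts with
    -- a part j > k.
    parity-count-Tail-∷-≢ : ∀ l {k w j} → j ≢ k →
                            parity (count (λ t → tail? k w ((j , false) ∷ t)) (Words l) +
                                    count (λ t → tail? k w ((j , true) ∷ t)) (Words l)) ≡ 0ℙ
    parity-count-Tail-∷-≢ l {k} {w} {j} j≢k with <-cmp j k
    ... | tri< j<k _ _ = begin
      parity (c false + c true)  ≡⟨ cong parity (cong₂ _+_ (count-Tail-∷-precedes l (strict j<k))
                                                         (count-Tail-∷-precedes l (strict j<k))) ⟩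
      parity (X + X)             ≡⟨ ℙ.+-homo-+ X X ⟩
      parity X ℙ+ parity X      ≡⟨ ℙ.p+p≡0ℙ (parity X) ⟩
      0ℙ                         ∎
      where
      c : Bool → ℕ
      c b = count (λ t → tail? k w ((j , b) ∷ t)) (Words l)
      X : ℕ
      X = count (completes? j w) (Words l)
    ... | tri≈ _ j≡k _ = contradiction j≡k j≢k
    ... | tri> _ _ k<j = cong parity (cong₂ _+_
      (count-Tail-∷-¬precedes l λ { (strict j<k) → <-asym j<k k<j ; same → <-irrefl refl k<j })
      (count-Tail-∷-¬precedes l λ { (strict j<k) → <-asym j<k k<j }))

    parity-count-Tail : ∀ l {k} w → 1 ≤ k → Allowed k → k ≤ N →
                        parity (count (tail? k w) (Words l)) ≡ parity (𝟙 (w ≟ l * k))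
    parity-count-Tail zero {k} w _ _ _ =
      cong parity (trans (+-identityʳ _) (𝟙-cong (tail? k w []) (w ≟ 0)
        (mk⇔ (λ (_ , _ , _ , 0≡w) → sym 0≡w) (λ w≡0 → [ _ ] , [] , [] , sym w≡0))))
    parity-count-Tail (suc l) {k} w 1≤k k-allowed k≤N = begin
      parity (count (tail? k w) (Words (suc l)))      ≡⟨ cong parity (count-Words-suc l (tail? k w)) ⟩
      parity (∑[ j < suc N ] (c j false + c j true))
        ≡⟨ parity-∑-single (suc N) (λ j → c j false + c j true) (s≤s k≤N) (λ _ → parity-count-Tail-∷-≢ l) ⟩
      parity (c k false + c k true)
        ≡⟨ cong parity (cong₂ _+_ (count-Tail-∷-precedes l same)
                                  (count-Tail-∷-¬precedes l λ { (strict k<k) → <-irrefl refl k<k })) ⟩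
      parity (X + 0)                                  ≡⟨ cong parity (+-identityʳ X) ⟩
      parity X                                        ≡⟨ parity-X (k ≤? w) ⟩
      parity (𝟙 (w ≟ suc l * k))                      ∎
      where
      c : ℕ → Bool → ℕ
      c j b = count (λ t → tail? k w ((j , b) ∷ t)) (Words l)
      X : ℕ
      X = count (completes? k w) (Words l)
      parity-X : Dec (k ≤ w) → parity X ≡ parity (𝟙 (w ≟ suc l * k))
      parity-X (yes k≤w) = begin
        parity X
          ≡⟨ cong parity (count-cong _ (tail? k (w ∸ k)) (λ _ → Completes⇔Tail 1≤k k-allowed k≤w) (Words l)) ⟩
        parity (count (tail? k (w ∸ k)) (Words l))  ≡⟨ parity-count-Tail l (w ∸ k) 1≤k k-allowed k≤N ⟩
        parity (𝟙 (w ∸ k ≟ l * k))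
          ≡⟨ cong parity (𝟙-cong (w ∸ k ≟ l * k) (w ≟ suc l * k) (∸≡⇔≡+ k≤w)) ⟩
        parity (𝟙 (w ≟ suc l * k))                  ∎
      parity-X (no k≰w) = cong parity (trans
        (count-none (completes? k w) (λ _ (_ , _ , k≤w , _) → k≰w k≤w) (Words l))
        (sym (𝟙-no (w ≟ suc l * k) (λ w≡k+lk → k≰w (subst (k ≤_) (sym w≡k+lk) (m≤m+n k (l * k)))))))

    -- The overpartitions counted by B̄(N) whose largest part is not overlined.
    halfBbar : ℕ
    halfBbar = ∑[ l < N ] ∑[ j < suc N ] count (completes? j N) (Words l)

    Bbar≡halfBbar+halfBbar : N ≢ 0 → Bbar ℓ₁ ℓ₂ N ≡ halfBbar + halfBbar
    Bbar≡halfBbar+halfBbar N≢0 = begin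
      Bbar ℓ₁ ℓ₂ N                                               ≡⟨ length-filter≡count isB?′ (candidates N) ⟩
      count isB?′ (candidates N)                                  ≡⟨ sum-map-concatMap (λ t → 𝟙 (isB?′ t)) Words (upTo (suc N)) ⟩
      sum (map (count isB?′ ∘ Words) (upTo (suc N)))              ≡⟨ sum-map-applyUpTo (count isB?′ ∘ Words) (λ l → l) (suc N) ⟩
      count isB?′ (Words 0) + ∑[ l < N ] count isB?′ (Words (suc l))
        ≡⟨ cong₂ _+_ (trans (+-identityʳ _) (𝟙-no (isB?′ []) (λ ((_ , _ , 0≡N) , _) → N≢0 (sym 0≡N))))
                     (∑-cong N (λ {l} _ → doubled l)) ⟩
      ∑[ l < N ] (X l + X l)                                      ≡⟨ ∑-distrib-+ N X X ⟩
      halfBbar + halfBbar                                         ∎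
      where
      isB?′ = isB? ℓ₁ ℓ₂ N
      X : ℕ → ℕ
      X l = ∑[ j < suc N ] count (completes? j N) (Words l)
      doubled : ∀ l → count isB?′ (Words (suc l)) ≡ X l + X l
      doubled l = begin
        count isB?′ (Words (suc l))
          ≡⟨ count-Words-suc l isB?′ ⟩
        ∑[ j < suc N ] (count (λ t → isB?′ ((j , false) ∷ t)) (Words l) +
                        count (λ t → isB?′ ((j , true) ∷ t)) (Words l))
          ≡⟨ ∑-cong (suc N) (λ {j} _ → cong₂ _+_ (first-part j false) (first-part j true)) ⟩
        ∑[ j < suc N ] (Y j + Y j)
          ≡⟨ ∑-distrib-+ (suc N) Y Y ⟩
        X l + X l
          ∎
        where
        Y : ℕ → ℕ
        Y j = count (completes? j N) (Words l)
        first-part : ∀ j b → count (λ t → isB?′ ((j , b) ∷ t)) (Words l) ≡ Y j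
        first-part j b = count-cong _ (completes? j N) (λ _ → IsB-∷⇔Completes) (Words l)

    parity-halfBbar : parity halfBbar ≡ parity (divisorCount positiveAllowed? N)
    parity-halfBbar = begin
      parity halfBbar
        ≡⟨ cong parity (∑-comm N (suc N) (λ l j → count (completes? j N) (Words l))) ⟩
      parity (∑[ j < suc N ] ∑[ l < N ] count (completes? j N) (Words l))
        ≡⟨ parity-∑-cong (suc N) {λ j → ∑[ l < N ] count (completes? j N) (Words l)}
                                 {λ j → 𝟙 (positiveAllowed? j ×-dec j ∣? N)}
                                 (λ j<1+N → per-part (positiveAllowed? _) (≤-pred j<1+N)) ⟩
      parity (divisorCount positiveAllowed? N)
        ∎
      where
      per-part : ∀ {j} → Dec (PositiveAllowed j) → j ≤ N →
                 parity (∑[ l < N ] count (completes? j N) (Words l)) ≡ parity (𝟙 (positiveAllowed? j ×-dec j ∣? N))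
      per-part {j} (yes (1≤j , j-allowed)) j≤N = begin
        parity (∑[ l < N ] count (completes? j N) (Words l))
          ≡⟨ parity-∑-cong N (λ {l} _ → trans
               (cong parity (count-cong _ (tail? j (N ∸ j)) (λ _ → Completes⇔Tail 1≤j j-allowed j≤N) (Words l)))
               (parity-count-Tail l (N ∸ j) 1≤j j-allowed j≤N)) ⟩
        parity (∑[ l < N ] 𝟙 (N ∸ j ≟ l * j))
          ≡⟨ cong parity (∑-𝟙-∸≡multiple 1≤j j≤N) ⟩
        parity (𝟙 (j ∣? N))
          ≡⟨ cong parity (𝟙-cong (j ∣? N) (positiveAllowed? j ×-dec j ∣? N) (mk⇔ ((1≤j , j-allowed) ,_) proj₂)) ⟩
        parity (𝟙 (positiveAllowed? j ×-dec j ∣? N))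
          ∎
      per-part {j} (no ¬allowed) _ = begin
        parity (∑[ l < N ] count (completes? j N) (Words l))
          ≡⟨ cong parity (∑-zero N (λ {l} _ →
               count-none _ (λ _ (1≤j , j-allowed , _) → ¬allowed (1≤j , j-allowed)) (Words l))) ⟩
        0ℙ
          ≡⟨ cong parity (𝟙-no (positiveAllowed? j ×-dec j ∣? N) (¬allowed ∘ proj₁)) ⟨
        parity (𝟙 (positiveAllowed? j ×-dec j ∣? N))
          ∎

proposition5p1 : ∀ (n : ℕ) → 4 ∣ Bbar 5 2 (4 * n + 3)
proposition5p1 n =
  subst (4 ∣_) (sym (Bbar≡halfBbar+halfBbar 5 2 N N≢0)) (2∣⇒4∣m+m (parity≡0ℙ⇒2∣ (halfBbar 5 2 N) half-even))
  where
  N = 4 * n + 3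
  N≡3 : N % 4 ≡ 3
  N≡3 = trans (cong (_% 4) (trans (+-comm (4 * n) 3) (cong (3 +_) (*-comm 4 n)))) ([m+kn]%n≡m%n 3 n 4)
  N≢0 : N ≢ 0
  N≢0 = ≡3-mod-4⇒≢0 N≡3
  odd-divisor-allowed : ∀ {j} → j ∣ N → PositiveAllowed 5 2 j ⇔ (¬ 5 ∣ j)
  odd-divisor-allowed j∣N = mk⇔ (proj₁ ∘ proj₂)
    (λ 5∤j → n≢0⇒n>0 (λ { refl → N≢0 (0∣⇒≡0 j∣N) }) , 5∤j ,
             λ 2∣j → ≡3-mod-4⇒odd N≡3 (∣-trans 2∣j j∣N))
  half-even : parity (halfBbar 5 2 N) ≡ 0ℙ
  half-even = begin
    parity (halfBbar 5 2 N)                          ≡⟨ parity-halfBbar 5 2 N ⟩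
    parity (divisorCount (positiveAllowed? 5 2) N)
      ≡⟨ cong parity (divisorCount-cong (positiveAllowed? 5 2) (λ j → ¬? (5 ∣? j)) odd-divisor-allowed) ⟩
    parity (divisorCount (λ j → ¬? (5 ∣? j)) N)      ≡⟨ divisorCount-∤-even (from-yes (prime? 5)) refl N N≡3 ⟩
    0ℙ                                               ∎
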